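{- For every integer $n \geq 3$, $\nabla(C_{3} \times C_{n}) \geq n+1$.
   Context: For a simple graph $G$, a set $S \subseteq V(G)$ is a decycling set of $G$ if the graph $G - S$ obtained by deleting the vertices of $S$ is acyclic (a forest). The decycling number $\nabla(G)$ is the minimum cardinality of a decycling set of $G$. $C_k$ denotes the cycle on $k$ vertices, and $G \times H$ denotes the Cartesian product of graphs: vertex set $V(G)\times V(H)$, with $(g,h)$ adjacent to $(g',h')$ iff either $g=g'$ and $hh' \in E(H)$, or $h=h'$ and $gg' \in E(G)$. -}

module Defs where

open import Data.Nat using (ℕ; zero; suc; _+_; _≤_; _<_)
open import Data.Fin using (Fin; toℕ)
open import Data.Product using (_×_; _,_; ∃-syntax; proj₁; proj₂)
open import Data.Sum using (_⊎_)
open import Data.List using (List; length)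
open import Data.List.Membership.Propositional using (_∈_; _∉_)
open import Data.List.Relation.Unary.Unique.Propositional using (Unique)
open import Relation.Binary.PropositionalEquality using (_≡_; _≢_)
open import Relation.Nullary using (¬_)

-- Cycle C_k on vertex set Fin k: i ~ j iff j ≡ i+1 (mod k) or i ≡ j+1 (mod k).
-- (Used for k ≥ 3, so this is a simple graph.)
SuccMod : (k : ℕ) → Fin k → Fin k → Set
SuccMod (suc k) i j = toℕ j ≡ suc (toℕ i) ⊎ (toℕ i ≡ k × toℕ j ≡ 0)
SuccMod zero () _

CycleAdj : (k : ℕ) → Fin k → Fin k → Set
CycleAdj k i j = SuccMod k i j ⊎ SuccMod k j i

ProdAdj : {V W : Set} → (V → V → Set) → (W → W → Set) → (V × W) → (V × W) → Set
ProdAdj A B (g , h) (g' , h') = (g ≡ g' × B h h') ⊎ (h ≡ h' × A g g')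

record CycleAvoiding {V : Set} (Adj : V → V → Set) (S : List V) : Set where
  field
    len      : ℕ
    len≥3    : 3 ≤ len
    vert     : Fin len → V
    distinct : ∀ i j → vert i ≡ vert j → i ≡ j
    avoids   : ∀ i → vert i ∉ S
    adjacent : ∀ i j → SuccMod len i j → Adj (vert i) (vert j)

AcyclicAfterDeleting : {V : Set} → (V → V → Set) → List V → Set
AcyclicAfterDeleting Adj S = ¬ CycleAvoiding Adj S

-- S (a duplicate-free list of vertices, i.e. a finite vertex set) is a decycling set.
IsDecyclingSet : {V : Set} → (V → V → Set) → List V → Set
IsDecyclingSet Adj S = Unique S × AcyclicAfterDeleting Adj S

IsDecyclingNumber : {V : Set} → (V → V → Set) → ℕ → Set
IsDecyclingNumber {V} Adj d =
  (∃[ S ] (IsDecyclingSet Adj S × length S ≡ d)) ×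
  (∀ (S : List V) → IsDecyclingSet Adj S → d ≤ length S)

C3×CnAdj : (n : ℕ) → (Fin 3 × Fin n) → (Fin 3 × Fin n) → Set
C3×CnAdj n = ProdAdj (CycleAdj 3) (CycleAdj n)

-- A decycling set S of C₃ × Cₙ must meet every column {0,1,2} × {c}, since each column is a
-- triangle. If it met every column exactly once, say in row f c, one could walk once around
-- the product avoiding S: in column j enter in some free row, move inside the column to the
-- row different from f j and f (j+1) if necessary, and step to column j+1 there. Closing the
-- walk up gives a cycle in the complement of S, so some column contains two vertices of S.
module Submission where

open import Defs
open import Data.Nat using (ℕ; zero; suc; _+_; _≤_; _<_; z≤n; s≤s; z<s)
open import Data.Nat.Properties
  using (suc-injective; ≤-refl; ≤-trans; ≤-reflexive; <⇒≤; <-irrefl; n<1+n; n≤1+n; m≤n+m; +-suc; +-comm)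
open import Data.Nat.DivMod using (_mod_; m<n⇒m%n≡m; n%n≡0)
open import Data.Fin as Fin using (Fin; toℕ)
open import Data.Fin.Properties using (toℕ-fromℕ<; toℕ-injective; injective⇒≤; any?)
  renaming (_≟_ to _≟ᶠ_)
open import Data.Product using (_×_; _,_; proj₁; proj₂; ∃)
open import Data.Product.Properties using (≡-dec)
open import Data.Sum using (inj₁; inj₂)
open import Data.List using (List; []; _∷_; _++_; [_]; length; lookup)
open import Data.List.Membership.Propositional using (_∈_; _∉_)
open import Data.List.Membership.Propositional.Properties using (∈-lookup)
import Data.List.Membership.DecPropositional as DecMembership
open import Data.List.Relation.Unary.All as All using (All; []; _∷_)
open import Data.List.Relation.Unary.Any as Any using ()
open import Data.List.Relation.Unary.Any.Properties using (lookup-index)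
open import Data.List.Relation.Unary.AllPairs using ([]; _∷_)
open import Data.List.Relation.Unary.Linked using (Linked; [-]; _∷_)
open import Data.List.Relation.Unary.Unique.Propositional using (Unique)
open import Relation.Binary.PropositionalEquality using (_≡_; _≢_; refl; sym; trans; cong; subst)
open import Relation.Nullary using (Dec; yes; no; ¬_)
open import Relation.Nullary.Decidable using (¬?; _×-dec_; decidable-stable)
open import Data.Empty using (⊥-elim)
open import Function using (case_of_)

pattern 0F = Fin.zero
pattern 1F = Fin.suc Fin.zero
pattern 2F = Fin.suc (Fin.suc Fin.zero)

module _ {V : Set} where

  Unique⇒lookup-injective : ∀ {xs : List V} → Unique xs → ∀ i j → lookup xs i ≡ lookup xs j → i ≡ j
  Unique⇒lookup-injective (_ ∷ _)  0F          0F          _  = refl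
  Unique⇒lookup-injective (x∉ ∷ _) 0F          (Fin.suc j) eq = ⊥-elim (All.lookup x∉ (∈-lookup j) eq)
  Unique⇒lookup-injective (x∉ ∷ _) (Fin.suc i) 0F          eq = ⊥-elim (All.lookup x∉ (∈-lookup i) (sym eq))
  Unique⇒lookup-injective (_ ∷ u)  (Fin.suc i) (Fin.suc j) eq = cong Fin.suc (Unique⇒lookup-injective u i j eq)

  Linked-lookup : ∀ {R : V → V → Set} {y : V} (xs : List V) (i j : Fin (length xs)) →
                  Linked R (xs ++ [ y ]) → toℕ j ≡ suc (toℕ i) → R (lookup xs i) (lookup xs j)
  Linked-lookup (_ ∷ [])     0F          0F                _ ()
  Linked-lookup (_ ∷ _ ∷ _)  0F          0F                _ ()
  Linked-lookup (_ ∷ _ ∷ _)  0F          1F                (r ∷ _) _ = r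
  Linked-lookup (_ ∷ _ ∷ _)  0F          (Fin.suc (Fin.suc _)) _ ()
  Linked-lookup (_ ∷ _ ∷ _)  (Fin.suc _) 0F                _ ()
  Linked-lookup (_ ∷ x ∷ xs) (Fin.suc i) (Fin.suc j)       (_ ∷ l) eq =
    Linked-lookup (x ∷ xs) i j l (suc-injective eq)

  Linked-lookup-last : ∀ {R : V → V → Set} {y : V} (x : V) (xs : List V) (i : Fin (length (x ∷ xs))) →
                       Linked R (x ∷ xs ++ [ y ]) → toℕ i ≡ length xs → R (lookup (x ∷ xs) i) y
  Linked-lookup-last _ []       0F          (r ∷ [-]) _ = r
  Linked-lookup-last _ (_ ∷ _)  0F          _        ()
  Linked-lookup-last _ (x ∷ xs) (Fin.suc i) (_ ∷ l)  eq = Linked-lookup-last x xs i l (suc-injective eq)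

  closedWalk⇒cycle : ∀ {Adj : V → V → Set} {S : List V} {x : V} {xs : List V} →
                     3 ≤ length (x ∷ xs) → Unique (x ∷ xs) → All (_∉ S) (x ∷ xs) →
                     Linked Adj (x ∷ xs ++ [ x ]) → CycleAvoiding Adj S
  closedWalk⇒cycle {Adj} {x = x} {xs} 3≤len unique avoids linked = record
    { len      = length (x ∷ xs)
    ; len≥3    = 3≤len
    ; vert     = lookup (x ∷ xs)
    ; distinct = Unique⇒lookup-injective unique
    ; avoids   = λ i → All.lookup avoids (∈-lookup i)
    ; adjacent = adjacent
    }
    where
    adjacent : ∀ i j → SuccMod (length (x ∷ xs)) i j → Adj (lookup (x ∷ xs) i) (lookup (x ∷ xs) j)
    adjacent i j           (inj₁ j≡1+i)       = Linked-lookup (x ∷ xs) i j linked j≡1+i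
    adjacent i 0F          (inj₂ (i≡last , _)) = Linked-lookup-last x xs i linked i≡last
    adjacent i (Fin.suc _) (inj₂ (_ , ()))

  ∈-injection⇒≤-length : ∀ {m} (S : List V) (h : Fin m → V) →
                         (∀ i j → h i ≡ h j → i ≡ j) → (∀ i → h i ∈ S) → m ≤ length S
  ∈-injection⇒≤-length S h h-inj h∈S = injective⇒≤ {f = λ i → Any.index (h∈S i)} λ {i} {j} eq →
    h-inj i j (trans (lookup-index (h∈S i)) (trans (cong (lookup S) eq) (sym (lookup-index (h∈S j)))))

third : Fin 3 → Fin 3 → Fin 3
third 0F 0F = 1F
third 0F 1F = 2F
third 0F 2F = 1F
third 1F 0F = 2F
third 1F 1F = 0F
third 1F 2F = 0F
third 2F 0F = 1F
third 2F 1F = 0F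
third 2F 2F = 0F

third-fresh : ∀ a b → third a b ≢ a × third a b ≢ b
third-fresh 0F 0F = (λ ()) , (λ ())
third-fresh 0F 1F = (λ ()) , (λ ())
third-fresh 0F 2F = (λ ()) , (λ ())
third-fresh 1F 0F = (λ ()) , (λ ())
third-fresh 1F 1F = (λ ()) , (λ ())
third-fresh 1F 2F = (λ ()) , (λ ())
third-fresh 2F 0F = (λ ()) , (λ ())
third-fresh 2F 1F = (λ ()) , (λ ())
third-fresh 2F 2F = (λ ()) , (λ ())

C₃-complete : ∀ a b → a ≢ b → CycleAdj 3 a b
C₃-complete 0F 0F a≢b = ⊥-elim (a≢b refl)
C₃-complete 0F 1F _   = inj₁ (inj₁ refl)
C₃-complete 0F 2F _   = inj₂ (inj₂ (refl , refl))
C₃-complete 1F 0F _   = inj₂ (inj₁ refl)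
C₃-complete 1F 1F a≢b = ⊥-elim (a≢b refl)
C₃-complete 1F 2F _   = inj₁ (inj₁ refl)
C₃-complete 2F 0F _   = inj₁ (inj₂ (refl , refl))
C₃-complete 2F 1F _   = inj₂ (inj₁ refl)
C₃-complete 2F 2F a≢b = ⊥-elim (a≢b refl)

module TransversalCycle (k : ℕ) (S : List (Fin 3 × Fin (suc k))) (f : Fin (suc k) → Fin 3)
                        (S⊆graph : ∀ {r c} → (r , c) ∈ S → r ≡ f c) (3≤n : 3 ≤ suc k) where

  n : ℕ
  n = suc k

  V : Set
  V = Fin 3 × Fin n

  Adj : V → V → Set
  Adj = C3×CnAdj n

  column : ℕ → Fin n
  column j = j mod n

  toℕ-column : ∀ {j} → j < n → toℕ (column j) ≡ j
  toℕ-column j<n = trans (toℕ-fromℕ< _) (m<n⇒m%n≡m j<n)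

  column-wraps : column n ≡ column 0
  column-wraps = toℕ-injective (trans (toℕ-fromℕ< _) (trans (n%n≡0 n) (sym (toℕ-column z<s))))

  blocked : ℕ → Fin 3
  blocked j = f (column j)

  exit : ℕ → Fin 3
  exit j = third (blocked j) (blocked (suc j))

  exit-free : ∀ j → exit j ≢ blocked j
  exit-free j = proj₁ (third-fresh (blocked j) (blocked (suc j)))

  exit-free-next : ∀ j → exit j ≢ blocked (suc j)
  exit-free-next j = proj₂ (third-fresh (blocked j) (blocked (suc j)))

  detour : ℕ → Fin 3 → List V
  detour j e with e ≟ᶠ exit j
  ... | yes _ = []
  ... | no  _ = [ exit j , column j ]

  walk : ℕ → ℕ → Fin 3 → List V
  walk j zero    e = []
  walk j (suc r) e = (e , column j) ∷ detour j e ++ walk (suc j) r (exit j)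

  horizontal : ∀ x {j} → suc j < n → Adj (x , column j) (x , column (suc j))
  horizontal x {j} 1+j<n = inj₁ (refl , inj₁ (inj₁
    (trans (toℕ-column 1+j<n) (cong suc (sym (toℕ-column (≤-trans (n≤1+n _) 1+j<n)))))))

  vertical : ∀ {a b} c → a ≢ b → Adj (a , c) (b , c)
  vertical {a} {b} _ a≢b = inj₂ (refl , C₃-complete a b a≢b)

  closing : Adj (exit k , column k) (exit k , column 0)
  closing = inj₁ (refl , inj₁ (inj₂ (toℕ-column (n<1+n k) , toℕ-column z<s)))

  walk-linked : ∀ r j e → r + j ≡ k → Linked Adj (walk j (suc r) e ++ [ exit k , column 0 ])
  walk-linked zero j e refl with e ≟ᶠ exit j
  ... | yes refl = closing ∷ [-]
  ... | no  e≢x  = vertical _ e≢x ∷ closing ∷ [-]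
  walk-linked (suc r) j e r+j≡k with e ≟ᶠ exit j
  ... | yes refl = horizontal _ 1+j<n ∷ walk-linked r (suc j) (exit j) (trans (+-suc r j) r+j≡k)
    where 1+j<n = s≤s (subst (suc j ≤_) r+j≡k (s≤s (m≤n+m j r)))
  ... | no  e≢x  = vertical _ e≢x ∷ horizontal _ 1+j<n ∷ walk-linked r (suc j) (exit j) (trans (+-suc r j) r+j≡k)
    where 1+j<n = s≤s (subst (suc j ≤_) r+j≡k (s≤s (m≤n+m j r)))

  head<n : ∀ {r j} → suc r + j ≤ n → j < n
  head<n {r} {j} bound = ≤-trans (s≤s (m≤n+m j r)) bound

  tail-bound : ∀ {r j} → suc r + j ≤ n → r + suc j ≤ n
  tail-bound {r} {j} bound = subst (_≤ n) (sym (+-suc r j)) bound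

  walk-columns : ∀ r j e → r + j ≤ n → All (λ v → j ≤ toℕ (proj₂ v)) (walk j r e)
  walk-columns zero    j e _ = []
  walk-columns (suc r) j e bound with e ≟ᶠ exit j
  ... | yes _ = ≤-reflexive (sym (toℕ-column (head<n bound)))
              ∷ All.map <⇒≤ (walk-columns r (suc j) (exit j) (tail-bound bound))
  ... | no  _ = ≤-reflexive (sym (toℕ-column (head<n bound)))
              ∷ ≤-reflexive (sym (toℕ-column (head<n bound)))
              ∷ All.map <⇒≤ (walk-columns r (suc j) (exit j) (tail-bound bound))

  left-of : ∀ {j x} → j < n → (v : V) → suc j ≤ toℕ (proj₂ v) → (x , column j) ≢ v
  left-of j<n _ j<v refl = <-irrefl refl (subst (_ <_) (toℕ-column j<n) j<v)

  walk-unique : ∀ r j e → r + j ≤ n → Unique (walk j r e)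
  walk-unique zero    j e _ = []
  walk-unique (suc r) j e bound with e ≟ᶠ exit j
  ... | yes _ = All.map (left-of (head<n bound) _) later ∷ walk-unique r (suc j) (exit j) (tail-bound bound)
    where later = walk-columns r (suc j) (exit j) (tail-bound bound)
  ... | no e≢x = ((λ eq → e≢x (cong proj₁ eq)) ∷ All.map (left-of (head<n bound) _) later)
               ∷ All.map (left-of (head<n bound) _) later ∷ walk-unique r (suc j) (exit j) (tail-bound bound)
    where later = walk-columns r (suc j) (exit j) (tail-bound bound)

  free : ∀ {x} j → x ≢ blocked j → (x , column j) ∉ S
  free _ x≢b x∈S = x≢b (S⊆graph x∈S)

  walk-avoids : ∀ r j e → e ≢ blocked j → All (_∉ S) (walk j r e)
  walk-avoids zero    j e _   = []
  walk-avoids (suc r) j e e≢b with e ≟ᶠ exit j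
  ... | yes _ = free j e≢b ∷ walk-avoids r (suc j) (exit j) (exit-free-next j)
  ... | no  _ = free j e≢b ∷ free j (exit-free j) ∷ walk-avoids r (suc j) (exit j) (exit-free-next j)

  walk-length : ∀ r j e → r ≤ length (walk j r e)
  walk-length zero    j e = z≤n
  walk-length (suc r) j e with e ≟ᶠ exit j
  ... | yes _ = s≤s (walk-length r (suc j) (exit j))
  ... | no  _ = s≤s (≤-trans (walk-length r (suc j) (exit j)) (n≤1+n _))

  start-free : exit k ≢ blocked 0
  start-free eq = exit-free-next k (trans eq (cong f (sym column-wraps)))

  -- The walk enters column 0 in the row in which it leaves column k.
  cycle : CycleAvoiding Adj S
  cycle = closedWalk⇒cycle
    (≤-trans 3≤n (walk-length n 0 (exit k)))
    (walk-unique n 0 (exit k) (≤-reflexive (+-comm n 0)))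
    (walk-avoids n 0 (exit k) start-free)
    (walk-linked k 0 (exit k) (+-comm k 0))

missed-column⇒cycle : ∀ {n} (S : List (Fin 3 × Fin n)) c → ¬ (∃ λ r → (r , c) ∈ S) →
                      CycleAvoiding (C3×CnAdj n) S
missed-column⇒cycle S c missed = record
  { len      = 3
  ; len≥3    = ≤-refl
  ; vert     = λ r → (r , c)
  ; distinct = λ _ _ eq → cong proj₁ eq
  ; avoids   = λ r r∈S → missed (r , r∈S)
  ; adjacent = λ _ _ succ → inj₂ (refl , inj₁ succ)
  }

hit-twice⇒1+n≤length : ∀ {A : Set} {n} (S : List (A × Fin n)) (f : Fin n → A) → (∀ c → (f c , c) ∈ S) →
                       ∀ {a c} → (a , c) ∈ S → a ≢ f c → suc n ≤ length S
hit-twice⇒1+n≤length {A} {n} S f graph⊆S {a} {c} a∈S a≢fc = ∈-injection⇒≤-length S h h-injective h∈S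
  where
  h : Fin (suc n) → A × Fin n
  h 0F           = (a , c)
  h (Fin.suc c′) = (f c′ , c′)

  h∈S : ∀ i → h i ∈ S
  h∈S 0F           = a∈S
  h∈S (Fin.suc c′) = graph⊆S c′

  h-injective : ∀ i j → h i ≡ h j → i ≡ j
  h-injective 0F           0F           _  = refl
  h-injective 0F           (Fin.suc _)  eq = ⊥-elim (a≢fc (trans (cong proj₁ eq) (cong f (sym (cong proj₂ eq)))))
  h-injective (Fin.suc _)  0F           eq = ⊥-elim (a≢fc (trans (cong proj₁ (sym eq)) (cong f (cong proj₂ eq))))
  h-injective (Fin.suc _)  (Fin.suc _)  eq = cong Fin.suc (cong proj₂ eq)

_∈?_ : ∀ {n} (v : Fin 3 × Fin n) (S : List (Fin 3 × Fin n)) → Dec (v ∈ S)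
_∈?_ = DecMembership._∈?_ (≡-dec _≟ᶠ_ _≟ᶠ_)

acyclic⇒columns-hit : ∀ {n} (S : List (Fin 3 × Fin n)) → AcyclicAfterDeleting (C3×CnAdj n) S →
                      ∀ c → ∃ λ r → (r , c) ∈ S
acyclic⇒columns-hit S acyclic c with any? (λ r → (r , c) ∈? S)
... | yes hit  = hit
... | no  miss = ⊥-elim (acyclic (missed-column⇒cycle S c miss))

acyclic⇒1+n≤length : ∀ k → 3 ≤ suc k → (S : List (Fin 3 × Fin (suc k))) →
                     AcyclicAfterDeleting (C3×CnAdj (suc k)) S → suc (suc k) ≤ length S
acyclic⇒1+n≤length k 3≤n S acyclic =
  case any? (λ c → any? (λ r → ¬? (r ≟ᶠ hit-row c) ×-dec ((r , c) ∈? S))) of λ where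
    (yes (_ , _ , r≢ , r∈S)) → hit-twice⇒1+n≤length S hit-row (λ c → proj₂ (hit c)) r∈S r≢
    (no  none)             → ⊥-elim (acyclic (TransversalCycle.cycle k S hit-row (S⊆graph none) 3≤n))
  where
  hit : ∀ c → ∃ λ r → (r , c) ∈ S
  hit = acyclic⇒columns-hit S acyclic

  hit-row : Fin (suc k) → Fin 3
  hit-row c = proj₁ (hit c)

  S⊆graph : ¬ (∃ λ c → ∃ λ r → r ≢ hit-row c × (r , c) ∈ S) → ∀ {r c} → (r , c) ∈ S → r ≡ hit-row c
  S⊆graph none {r} {c} r∈S = decidable-stable (r ≟ᶠ hit-row c) (λ r≢ → none (c , r , r≢ , r∈S))

corollary1 : ∀ (n : ℕ) → 3 ≤ n → ∀ (d : ℕ) → IsDecyclingNumber (C3×CnAdj n) d → n + 1 ≤ d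
corollary1 (suc k) 3≤n _ ((S , (_ , acyclic) , |S|≡d) , _) =
  subst (suc k + 1 ≤_) |S|≡d (subst (_≤ length S) (+-comm 1 (suc k)) (acyclic⇒1+n≤length k 3≤n S acyclic))
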